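{- Let $M$ be a $k^7$-diamond-pattern; then $M$ contains a $k$-thick pattern.
   Context: For a matching with a separated layout (bipartite with parts $V_1,V_2$, all vertices of $V_1$ before all of $V_2$), edge $e$ is represented by the grid point $(x(e),y(e))$, with $x(e)$ the position of its $V_1$-endpoint and $y(e)$ that of its $V_2$-endpoint. Write $e_1 \nearrow e_2$ if $x(e_1)<x(e_2)$ and $y(e_1)<y(e_2)$, and $e_1 \searrow e_2$ if $x(e_1)<x(e_2)$ and $y(e_1)>y(e_2)$. An $n$-diamond-pattern is a matching of $n^2$ edges $e_{i,j}$, $1\le i,j\le n$, with $e_{i,j}\nearrow e_{i,j+1}$ for $1\le i\le n$, $1\le j<n$, and $e_{i,j}\searrow e_{i+1,j}$ for $1\le i<n$, $1\le j\le n$. A $k$-twist is a set of $k$ pairwise crossing edges and a $k$-rainbow a set of $k$ pairwise nesting edges. A $k$-thick pattern is either a $k$-thick $k$-twist (obtained from a $k$-twist by replacing each edge by a $k$-rainbow, i.e., $k$ pairwise vertex-disjoint $k$-rainbows where edges of different rainbows cross) or a $k$-thick $k$-rainbow (obtained from a $k$-rainbow by replacing each edge by a $k$-twist, i.e., $k$ pairwise nesting $k$-twists). A graph contains a pattern if the pattern is an ordered subgraph of it. -}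

module Defs where

open import Data.Nat using (ℕ; _<_)
open import Data.Fin using (Fin) renaming (_<_ to _<ᶠ_)
open import Data.Product using (_×_; _,_; proj₁; proj₂; Σ; ∃)
open import Relation.Binary.PropositionalEquality using (_≡_)
open import Data.Sum using (_⊎_)
import Data.Fin
import Data.Nat

-- An edge of a matching in a separated layout, represented by the grid point
-- (x(e), y(e)): positions of its V₁-endpoint and V₂-endpoint.
Edge : Set
Edge = ℕ × ℕ

x : Edge → ℕ
x = proj₁

y : Edge → ℕ
y = proj₂

_↗_ : Edge → Edge → Set
e₁ ↗ e₂ = (x e₁ < x e₂) × (y e₁ < y e₂)

_↘_ : Edge → Edge → Set
e₁ ↘ e₂ = (x e₁ < x e₂) × (y e₂ < y e₁)

IsMatching : {I : Set} → (I → Edge) → Set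
IsMatching {I} e = (i j : I) → (x (e i) ≡ x (e j) → i ≡ j) × (y (e i) ≡ y (e j) → i ≡ j)

IsDiamond : (n : ℕ) → (Fin n → Fin n → Edge) → Set
IsDiamond n e =
  IsMatching {Fin n × Fin n} (λ p → e (proj₁ p) (proj₂ p))
  × ((i j j′ : Fin n) → Data.Fin.toℕ j′ ≡ Data.Nat.suc (Data.Fin.toℕ j) → e i j ↗ e i j′)
  × ((i i′ j : Fin n) → Data.Fin.toℕ i′ ≡ Data.Nat.suc (Data.Fin.toℕ i) → e i j ↘ e i′ j)

-- k-thick k-twist (separated layout): k rainbows f a _ (edges within a rainbow
-- pairwise nest, i.e. ↘), edges of different rainbows pairwise cross (↗).
IsThickTwist : (k : ℕ) → (Fin k → Fin k → Edge) → Set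
IsThickTwist k f =
  ((a a′ b b′ : Fin k) → a <ᶠ a′ → f a b ↗ f a′ b′)
  × ((a b b′ : Fin k) → b <ᶠ b′ → f a b ↘ f a b′)

-- k-thick k-rainbow: k pairwise nesting k-twists.
IsThickRainbow : (k : ℕ) → (Fin k → Fin k → Edge) → Set
IsThickRainbow k f =
  ((a a′ b b′ : Fin k) → a <ᶠ a′ → f a b ↘ f a′ b′)
  × ((a b b′ : Fin k) → b <ᶠ b′ → f a b ↗ f a b′)

Contains : {I : Set} → (I → Edge) → (k : ℕ) → ((Fin k → Fin k → Edge) → Set) → Set
Contains {I} e k P = Σ (Fin k → Fin k → I) λ σ → P (λ a b → e (σ a b))

ContainsThick : {I : Set} → (I → Edge) → ℕ → Set
ContainsThick e k = Contains e k (IsThickTwist k) ⊎ Contains e k (IsThickRainbow k)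

-- Cut the grid into k × k blocks (k = m + 1) with block coordinates (R, C) in the diagonal
-- strip R ≤ C < R + δ.  In a block a column is a k-rainbow and a row is a k-twist, and since
-- y decreases along columns and increases along rows, the y-values of a block fill an
-- interval [lo, hi].  Blocks in product order with disjoint intervals have all edges
-- pairwise crossing or all pairwise nesting, so k of them with increasing (decreasing)
-- intervals form a k-thick twist (rainbow).  Otherwise Mirsky's theorem colours the blocks
-- with m² colours so that equally coloured blocks in product order have overlapping
-- intervals.  Let s be the block of a colour class with the largest lo.  A block of the class
-- whose row is at distance ≥ δ from that of s is comparable with s, hence contains lo s;
-- blocks on a common antidiagonal have disjoint intervals, so these far blocks lie on
-- distinct antidiagonals, and at most 2δ² blocks are near s.  For δ = 4m² and
-- L = 16m⁴ + 2m² + 1 the m² classes are too small to hold L·δ blocks, while L·δ blocks fit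
-- into a k⁷-diamond.

module Submission where

open import Defs
open import Data.Nat using (ℕ; zero; suc; _+_; _*_; _∸_; _^_; _≤_; _<_; z≤n; s≤s; s≤s⁻¹; _<?_; _≤?_)
open import Data.Nat.Properties
open import Data.Nat.Tactic.RingSolver using (solve-∀)
open import Data.Fin using (Fin; zero; suc; toℕ; fromℕ; fromℕ<; remQuot) renaming (_<_ to _<ᶠ_)
import Data.Fin.Properties as Fin
open import Data.List using (allFin)
open import Data.List.Relation.Unary.All using (lookup)
open import Data.List.Membership.Propositional.Properties using (∈-allFin)
open import Data.List.Extrema.Nat using (argmax; f[xs]≤f[argmax])
open import Data.Product using (_×_; _,_; proj₁; proj₂; Σ; ∃)
open import Data.Product.Properties using (,-injective; ≡-dec)
open import Data.Product.Function.NonDependent.Propositional using (_×-↔_)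
open import Data.Sum using (_⊎_; inj₁; inj₂; [_,_]′)
open import Data.Sum.Properties using (inj₁-injective; inj₂-injective)
open import Data.Sum.Function.Propositional using (_⊎-↔_)
open import Data.Empty using (⊥; ⊥-elim)
open import Data.Unit using (⊤; tt)
open import Function using (_∘_; case_of_; _↔_; Injection)
open import Function.Properties.Inverse using (↔-refl; ↔-sym; ↔-trans; ↔⇒↣)
open import Relation.Nullary using (Dec; yes; no; ¬_; contradiction)
open import Relation.Nullary.Decidable using (_×-dec_; _⊎-dec_)
open import Relation.Unary using (Pred)
open import Relation.Binary using (Rel; DecidableEquality; Transitive; Decidable; tri<; tri≈; tri>)
open import Relation.Binary.PropositionalEquality using (_≡_; _≢_; refl; sym; trans; cong; cong₂; subst)
open import Level using (0ℓ)

record Chain {A : Set} (_≺_ : Rel A 0ℓ) (k : ℕ) : Set where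
  constructor chain
  field
    element    : Fin k → A
    increasing : ∀ {i j} → i <ᶠ j → element i ≺ element j

Chain-map : {A B : Set} {_≺_ : Rel A 0ℓ} {_⊰_ : Rel B 0ℓ} (f : A → B) →
            (∀ {a b} → a ≺ b → f a ⊰ f b) → ∀ {k} → Chain _≺_ k → Chain _⊰_ k
Chain-map f f-mono (chain g g-increasing) = chain (f ∘ g) (f-mono ∘ g-increasing)

module Greatest {P : Pred ℕ 0ℓ} (P? : ∀ g → Dec (P g)) where

  greatest : ℕ → ℕ
  greatest zero = zero
  greatest (suc n) with P? (suc n)
  ... | yes _ = suc n
  ... | no _  = greatest n

  greatest≤ : ∀ n → greatest n ≤ n
  greatest≤ zero = z≤n
  greatest≤ (suc n) with P? (suc n)
  ... | yes _ = ≤-refl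
  ... | no _  = m≤n⇒m≤1+n (greatest≤ n)

  P-greatest : P zero → ∀ n → P (greatest n)
  P-greatest P0 zero = P0
  P-greatest P0 (suc n) with P? (suc n)
  ... | yes Pn = Pn
  ... | no _   = P-greatest P0 n

  ≤-greatest : ∀ {g} n → P g → g ≤ n → g ≤ greatest n
  ≤-greatest zero _ g≤0 = g≤0
  ≤-greatest {g} (suc n) Pg g≤1+n with P? (suc n) | m≤n⇒m<n∨m≡n g≤1+n
  ... | yes _  | _          = g≤1+n
  ... | no _   | inj₁ g<1+n = ≤-greatest n Pg (≤-pred g<1+n)
  ... | no ¬Pn | inj₂ refl  = contradiction Pg ¬Pn

module _ {n : ℕ} {_≺_ : Rel (Fin n) 0ℓ} (≺? : Decidable _≺_) (≺-trans : Transitive _≺_) where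

  Path : ℕ → Fin n → Set
  Path zero    b = ⊤
  Path (suc g) b = ∃ λ b′ → b ≺ b′ × Path g b′

  path? : ∀ g b → Dec (Path g b)
  path? zero    b = yes tt
  path? (suc g) b = Fin.any? λ b′ → ≺? b b′ ×-dec path? g b′

  vertex : ∀ {g b} → Path g b → Fin (suc g) → Fin n
  vertex {zero}  {b} _           _       = b
  vertex {suc g} {b} _           zero    = b
  vertex {suc g}     (_ , _ , p) (suc i) = vertex p i

  ≺-vertex : ∀ {g b b′} → b ≺ b′ → (p : Path g b′) (i : Fin (suc g)) → b ≺ vertex p i
  ≺-vertex {zero}  b≺b′ _             _       = b≺b′
  ≺-vertex {suc g} b≺b′ _             zero    = b≺b′
  ≺-vertex {suc g} b≺b′ (_ , b′≺ , p) (suc i) = ≺-vertex (≺-trans b≺b′ b′≺) p i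

  path⇒chain : ∀ {g b} → Path g b → Chain _≺_ (suc g)
  path⇒chain p = chain (vertex p) (increasing p)
    where
      increasing : ∀ {g b} (p : Path g b) {i j} → i <ᶠ j → vertex p i ≺ vertex p j
      increasing {suc g} (_ , b≺b′ , p) {zero}  {suc j} _   = ≺-vertex b≺b′ p j
      increasing {suc g} (_ , _    , p) {suc i} {suc j} i<j = increasing p (≤-pred i<j)

  chain⊎antichainColouring : ∀ m → Chain _≺_ (suc m)
                                  ⊎ Σ (Fin n → Fin m) λ c → ∀ {a b} → a ≺ b → c a ≢ c b
  chain⊎antichainColouring m with Fin.any? (path? m)
  ... | yes (_ , p) = inj₁ (path⇒chain p)
  ... | no ¬path    = inj₂ (colour , λ a≺b → <⇒≢ (height-≺ a≺b) ∘ sym ∘ colour-injective)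
    where
      module Longest b = Greatest (λ g → path? g b)

      height : Fin n → ℕ
      height b = Longest.greatest b m

      height-path : ∀ b → Path (height b) b
      height-path b = Longest.P-greatest b tt m

      height<m : ∀ b → height b < m
      height<m b = ≤∧≢⇒< (Longest.greatest≤ b m)
                         (λ h≡m → ¬path (b , subst (λ g → Path g b) h≡m (height-path b)))

      height-≺ : ∀ {a b} → a ≺ b → height b < height a
      height-≺ {a} {b} a≺b = Longest.≤-greatest a m (b , a≺b , height-path b) (height<m b)

      colour : Fin n → Fin m
      colour b = fromℕ< (height<m b)

      colour-injective : ∀ {a b} → colour a ≡ colour b → height a ≡ height b
      colour-injective = Fin.fromℕ<-injective _ _ _ _

↗-trans : Transitive _↗_
↗-trans (x< , y<) (x<′ , y<′) = <-trans x< x<′ , <-trans y< y<′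

↘-trans : Transitive _↘_
↘-trans (x< , y>) (x<′ , y>′) = <-trans x< x<′ , <-trans y>′ y>

module _ {A : Set} (_~_ : Rel A 0ℓ) (~-trans : Transitive _~_) {n : ℕ}
         (f : (i : ℕ) → .(i < n) → A) (step : ∀ {i} .p .q → f i p ~ f (suc i) q) where

  steps-increasing : ∀ {i j} .p .q → i < j → f i p ~ f j q
  steps-increasing {i} {suc j} p q i<1+j with m≤n⇒m<n∨m≡n (≤-pred i<1+j)
  ... | inj₁ i<j  = ~-trans (steps-increasing p (<-trans (n<1+n j) q) i<j) (step _ q)
  ... | inj₂ refl = step p q

module Diamond {N : ℕ} {e : Fin N → Fin N → Edge} (diamond : IsDiamond N e) where

  -- The bounds are irrelevant, so cells with equal coordinates are definitionally equal.
  at : (i j : ℕ) → .(i < N) → .(j < N) → Edge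
  at i j p q = e (fromℕ< p) (fromℕ< q)

  row-↗ : ∀ {i j j′} .p .q .q′ → j < j′ → at i j p q ↗ at i j′ p q′
  row-↗ {i} p = steps-increasing _↗_ ↗-trans (λ j q → at i j p q) step
    where
      step : ∀ {j} .q .q′ → at i j p q ↗ at i (suc j) p q′
      step q q′ = proj₁ (proj₂ diamond) _ _ _
        (trans (Fin.toℕ-fromℕ< q′) (cong suc (sym (Fin.toℕ-fromℕ< q))))

  col-↘ : ∀ {i i′ j} .p .p′ .q → i < i′ → at i j p q ↘ at i′ j p′ q
  col-↘ {j = j} p p′ q = steps-increasing _↘_ ↘-trans (λ i p → at i j p q) step p p′
    where
      step : ∀ {i} .p .p′ → at i j p q ↘ at (suc i) j p′ q
      step p p′ = proj₂ (proj₂ diamond) _ _ _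
        (trans (Fin.toℕ-fromℕ< p′) (cong suc (sym (Fin.toℕ-fromℕ< p))))

  x-< : ∀ {i i′ j j′} .p .p′ .q .q′ → i < i′ → j < j′ →
        x (at i j p q) < x (at i′ j′ p′ q′)
  x-< p p′ q q′ i<i′ j<j′ = <-trans (proj₁ (col-↘ p p′ q i<i′)) (proj₁ (row-↗ p′ q q′ j<j′))

  y-< : ∀ {i i′ j j′} .p .p′ .q .q′ → i′ < i → j < j′ →
        y (at i j p q) < y (at i′ j′ p′ q′)
  y-< p p′ q q′ i′<i j<j′ = <-trans (proj₂ (col-↘ p′ p q i′<i)) (proj₂ (row-↗ p′ q q′ j<j′))

  y-≤ : ∀ {i i′ j j′} .p .p′ .q .q′ → i′ ≤ i → j ≤ j′ →
        y (at i j p q) ≤ y (at i′ j′ p′ q′)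
  y-≤ p p′ q q′ i′≤i j≤j′ with m≤n⇒m<n∨m≡n i′≤i | m≤n⇒m<n∨m≡n j≤j′
  ... | inj₁ i′<i | inj₁ j<j′ = <⇒≤ (y-< p p′ q q′ i′<i j<j′)
  ... | inj₁ i′<i | inj₂ refl = <⇒≤ (proj₂ (col-↘ p′ p q i′<i))
  ... | inj₂ refl | inj₁ j<j′ = <⇒≤ (proj₂ (row-↗ p q q′ j<j′))
  ... | inj₂ refl | inj₂ refl = ≤-refl

m*n+o<m*p : ∀ m {n o p} → n < p → o < m → m * n + o < m * p
m*n+o<m*p m {n} {o} {p} n<p o<m = begin-strict
  m * n + o  <⟨ +-monoʳ-< (m * n) o<m ⟩
  m * n + m  ≡⟨ +-comm (m * n) m ⟩
  m + m * n  ≡⟨ *-suc m n ⟨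
  m * suc n  ≤⟨ *-monoʳ-≤ m n<p ⟩
  m * p      ∎
  where open ≤-Reasoning

module Blocks {N : ℕ} {e : Fin N → Fin N → Edge} (diamond : IsDiamond N e)
              (m a : ℕ) (fits : suc m * a ≤ N) where

  open Diamond diamond

  private
    k : ℕ
    k = suc m

    offset< : ∀ {r t} → r < a → t < k → k * r + t < N
    offset< r<a t<k = <-≤-trans (m*n+o<m*p k r<a t<k) fits

    block<block : ∀ {r r′ t t′} → r < r′ → t < k → k * r + t < k * r′ + t′
    block<block r<r′ t<k = <-≤-trans (m*n+o<m*p k r<r′ t<k) (m≤m+n _ _)

  record Block : Set where
    constructor block
    field
      row col : ℕ
      row<a   : row < a
      col<a   : col < a

  open Block

  position : Block → Fin k → Fin k → Fin N × Fin N
  position B t u = fromℕ< (offset< (row<a B) (Fin.toℕ<n t))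
                 , fromℕ< (offset< (col<a B) (Fin.toℕ<n u))

  cell : Block → Fin k → Fin k → Edge
  cell B t u = e (proj₁ (position B t u)) (proj₂ (position B t u))

  lo hi : Block → ℕ
  lo B = y (cell B (fromℕ m) zero)
  hi B = y (cell B zero (fromℕ m))

  lo≤cell : ∀ B t u → lo B ≤ y (cell B t u)
  lo≤cell B t u = y-≤ _ _ _ _ (+-monoʳ-≤ (k * row B) (Fin.≤fromℕ t)) (+-monoʳ-≤ (k * col B) z≤n)

  cell≤hi : ∀ B t u → y (cell B t u) ≤ hi B
  cell≤hi B t u = y-≤ _ _ _ _ (+-monoʳ-≤ (k * row B) z≤n) (+-monoʳ-≤ (k * col B) (Fin.≤fromℕ u))

  lo≤hi : ∀ B → lo B ≤ hi B
  lo≤hi B = ≤-trans (lo≤cell B zero zero) (cell≤hi B zero zero)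

  hi<lo : ∀ {B B′} → row B < row B′ → col B′ < col B → hi B′ < lo B
  hi<lo r<r′ c′<c =
    y-< _ _ _ _ (block<block r<r′ (Fin.toℕ<n (fromℕ m))) (block<block c′<c (Fin.toℕ<n (fromℕ m)))

  record _⇗_ (B B′ : Block) : Set where
    constructor all-↗
    field cells-↗ : ∀ t u t′ u′ → cell B t u ↗ cell B′ t′ u′

  record _⇘_ (B B′ : Block) : Set where
    constructor all-↘
    field cells-↘ : ∀ t u t′ u′ → cell B t u ↘ cell B′ t′ u′

  private
    cell-x-< : ∀ {B B′} → row B < row B′ → col B < col B′ →
               ∀ t u t′ u′ → x (cell B t u) < x (cell B′ t′ u′)
    cell-x-< r<r′ c<c′ t u t′ u′ =
      x-< _ _ _ _ (block<block r<r′ (Fin.toℕ<n t)) (block<block c<c′ (Fin.toℕ<n u))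

  ⇗-intro : ∀ {B B′} → row B < row B′ → col B < col B′ → hi B < lo B′ → B ⇗ B′
  ⇗-intro {B} {B′} r<r′ c<c′ hi<lo′ = all-↗ λ t u t′ u′ →
    cell-x-< {B} {B′} r<r′ c<c′ t u t′ u′ ,
    ≤-<-trans (cell≤hi B t u) (<-≤-trans hi<lo′ (lo≤cell B′ t′ u′))

  ⇘-intro : ∀ {B B′} → row B < row B′ → col B < col B′ → hi B′ < lo B → B ⇘ B′
  ⇘-intro {B} {B′} r<r′ c<c′ hi′<lo = all-↘ λ t u t′ u′ →
    cell-x-< {B} {B′} r<r′ c<c′ t u t′ u′ ,
    ≤-<-trans (cell≤hi B′ t′ u′) (<-≤-trans hi′<lo (lo≤cell B t u))

  thickTwist : Chain _⇗_ k → Contains (λ p → e (proj₁ p) (proj₂ p)) k (IsThickTwist k)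
  thickTwist (chain B B-⇗) =
    (λ a t → position (B a) t zero) ,
    (λ a a′ t t′ a<a′ → _⇗_.cells-↗ (B-⇗ a<a′) t zero t′ zero) ,
    (λ a t t′ t<t′ → col-↘ _ _ _ (+-monoʳ-< (k * row (B a)) t<t′))

  thickRainbow : Chain _⇘_ k → Contains (λ p → e (proj₁ p) (proj₂ p)) k (IsThickRainbow k)
  thickRainbow (chain B B-⇘) =
    (λ a t → position (B a) zero t) ,
    (λ a a′ t t′ a<a′ → _⇘_.cells-↘ (B-⇘ a<a′) zero t zero t′) ,
    (λ a t t′ t<t′ → row-↗ _ _ _ (+-monoʳ-< (k * col (B a)) t<t′))

module BlockCounting {n : ℕ} (m L δ : ℕ) (R I : Fin n → ℕ)
         (R<L : ∀ b → R b < L) (I<δ : ∀ b → I b < δ)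
         (RI-injective : ∀ {b b′} → R b ≡ R b′ → I b ≡ I b′ → b ≡ b′)
         (lo hi : Fin n → ℕ) (lo≤hi : ∀ b → lo b ≤ hi b)
         (hi<lo : ∀ {b b′} → R b < R b′ → R b′ + I b′ < R b + I b → hi b′ < lo b) where

  C : Fin n → ℕ
  C b = R b + I b

  Before : Rel (Fin n) 0ℓ
  Before b b′ = R b < R b′ × C b < C b′

  _⊏↑_ _⊏↓_ : Rel (Fin n) 0ℓ
  b ⊏↑ b′ = Before b b′ × hi b < lo b′
  b ⊏↓ b′ = Before b b′ × hi b′ < lo b

  Before-trans : Transitive Before
  Before-trans (r< , c<) (r<′ , c<′) = <-trans r< r<′ , <-trans c< c<′

  ⊏↑-trans : Transitive _⊏↑_
  ⊏↑-trans {_} {b} (bf , hi<lo) (bf′ , hi<lo′) =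
    Before-trans bf bf′ , <-trans hi<lo (≤-<-trans (lo≤hi b) hi<lo′)

  ⊏↓-trans : Transitive _⊏↓_
  ⊏↓-trans {_} {b} (bf , hi>lo) (bf′ , hi>lo′) =
    Before-trans bf bf′ , <-trans hi>lo′ (≤-<-trans (lo≤hi b) hi>lo)

  Before? : Decidable Before
  Before? b b′ = R b <? R b′ ×-dec C b <? C b′

  _⊏↑?_ : Decidable _⊏↑_
  b ⊏↑? b′ = Before? b b′ ×-dec hi b <? lo b′
  _⊏↓?_ : Decidable _⊏↓_
  b ⊏↓? b′ = Before? b b′ ×-dec hi b′ <? lo b

  Covers : Fin n → ℕ → Set
  Covers b v = lo b ≤ v × v ≤ hi b

  Far : Fin n → Fin n → Set
  Far s b = R b + δ ≤ R s ⊎ R s + δ ≤ R b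

  +δ≤⇒Before : ∀ {b b′} → R b + δ ≤ R b′ → Before b b′
  +δ≤⇒Before {b} {b′} b+δ≤b′ =
    ≤-<-trans (m≤m+n (R b) (I b)) C<R′ , <-≤-trans C<R′ (m≤m+n (R b′) (I b′))
    where
      C<R′ : C b < R b′
      C<R′ = <-≤-trans (+-monoʳ-< (R b) (I<δ b)) b+δ≤b′

  antidiagonal-R<⇒disjoint : ∀ {b₁ b₂ v} → R b₁ < R b₂ → R b₁ + C b₁ ≡ R b₂ + C b₂ →
                             Covers b₁ v → Covers b₂ v → ⊥
  antidiagonal-R<⇒disjoint {b₁} {b₂} r< diag (lo₁≤v , _) (_ , v≤hi₂) =
    <-irrefl refl (<-≤-trans (hi<lo r< C₂<C₁) (≤-trans lo₁≤v v≤hi₂))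
    where
      C₂<C₁ : C b₂ < C b₁
      C₂<C₁ = ≰⇒> λ C₁≤C₂ → <⇒≢ (+-mono-<-≤ r< C₁≤C₂) diag

  antidiagonal-unique : ∀ {b₁ b₂ v} → Covers b₁ v → Covers b₂ v →
                        R b₁ + C b₁ ≡ R b₂ + C b₂ → b₁ ≡ b₂
  antidiagonal-unique {b₁} {b₂} cov₁ cov₂ diag with <-cmp (R b₁) (R b₂)
  ... | tri< r< _ _ = ⊥-elim (antidiagonal-R<⇒disjoint r< diag cov₁ cov₂)
  ... | tri> _ _ r> = ⊥-elim (antidiagonal-R<⇒disjoint r> (sym diag) cov₂ cov₁)
  ... | tri≈ _ r≡ _ =
    RI-injective r≡ (+-cancelˡ-≡ (R b₁) _ _ (trans C≡ (cong (_+ I b₂) (sym r≡))))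
    where
      C≡ : C b₁ ≡ C b₂
      C≡ = +-cancelˡ-≡ (R b₁) _ _ (trans diag (cong (_+ C b₂) (sym r≡)))

  far? : ∀ s b → Dec (Far s b)
  far? s b = R b + δ ≤? R s ⊎-dec R s + δ ≤? R b

  near-offset< : ∀ {s b} → ¬ Far s b → R b + δ ∸ R s < δ + δ
  near-offset< {s} {b} near = begin-strict
    R b + δ ∸ R s          <⟨ ∸-monoˡ-< b+δ<s+2δ (<⇒≤ (≰⇒> (near ∘ inj₁))) ⟩
    R s + (δ + δ) ∸ R s    ≡⟨ m+n∸m≡n (R s) (δ + δ) ⟩
    δ + δ                  ∎
    where
      open ≤-Reasoning
      b+δ<s+2δ : R b + δ < R s + (δ + δ)
      b+δ<s+2δ = subst (R b + δ <_) (+-assoc (R s) δ δ) (+-monoˡ-< δ (≰⇒> (near ∘ inj₂)))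

  -- Relative to the leader s of its class, a far block covers lo s and is determined by its
  -- antidiagonal R + C, a near block by its offset R + δ ∸ R s and I.
  Tag : Set
  Tag = Fin (L + (L + δ)) ⊎ (Fin (δ + δ) × Fin δ)

  tag : Fin n → Fin n → Tag
  tag s b with far? s b
  ... | yes _    = inj₁ (fromℕ< (+-mono-< (R<L b) (+-mono-< (R<L b) (I<δ b))))
  ... | no near  = inj₂ (fromℕ< (near-offset< near) , fromℕ< (I<δ b))

  tag-injective : ∀ s {b₁ b₂} →
                  (Far s b₁ → Covers b₁ (lo s)) → (Far s b₂ → Covers b₂ (lo s)) →
                  tag s b₁ ≡ tag s b₂ → b₁ ≡ b₂
  tag-injective s {b₁} {b₂} cov₁ cov₂ eq with far? s b₁ | far? s b₂
  ... | yes far₁  | yes far₂  = antidiagonal-unique (cov₁ far₁) (cov₂ far₂)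
                                  (Fin.fromℕ<-injective _ _ _ _ (inj₁-injective eq))
  ... | yes _     | no _      = case eq of λ ()
  ... | no _      | yes _     = case eq of λ ()
  ... | no near₁  | no near₂  = RI-injective R≡ (Fin.fromℕ<-injective _ _ _ _ (proj₂ offset,I≡))
    where
      offset,I≡ : fromℕ< (near-offset< near₁) ≡ fromℕ< (near-offset< near₂)
                × fromℕ< (I<δ b₁) ≡ fromℕ< (I<δ b₂)
      offset,I≡ = ,-injective (inj₂-injective eq)
      R≡ : R b₁ ≡ R b₂
      R≡ = +-cancelʳ-≡ δ _ _
             (∸-cancelʳ-≡ (<⇒≤ (≰⇒> (near₁ ∘ inj₁))) (<⇒≤ (≰⇒> (near₂ ∘ inj₁)))
                          (Fin.fromℕ<-injective _ _ _ _ (proj₁ offset,I≡)))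

  module Colouring (b₀ : Fin n)
                   (up   : Fin n → Fin m) (up-sep   : ∀ {a b} → a ⊏↑ b → up a ≢ up b)
                   (down : Fin n → Fin m) (down-sep : ∀ {a b} → a ⊏↓ b → down a ≢ down b) where

    Colour : Set
    Colour = Fin m × Fin m

    colour : Fin n → Colour
    colour b = up b , down b

    _≟ᶜ_ : DecidableEquality Colour
    _≟ᶜ_ = ≡-dec Fin._≟_ Fin._≟_

    -- key c vanishes outside the class c, so its argmax lies in c and maximises lo there.
    key : Colour → Fin n → ℕ
    key c b with colour b ≟ᶜ c
    ... | yes _ = suc (lo b)
    ... | no _  = zero

    leader : Colour → Fin n
    leader c = argmax (key c) b₀ (allFin n)

    leader-spec : ∀ {b c} → colour b ≡ c → colour (leader c) ≡ c × lo b ≤ lo (leader c)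
    leader-spec {b} {c} b∈c = key-≤ (lookup (f[xs]≤f[argmax] b₀ (allFin n)) (∈-allFin b))
      where
        key-≤ : ∀ {b′} → key c b ≤ key c b′ → colour b′ ≡ c × lo b ≤ lo b′
        key-≤ {b′} le with colour b ≟ᶜ c | colour b′ ≟ᶜ c
        ... | yes _ | yes b′∈c = b′∈c , s≤s⁻¹ le
        ... | yes _ | no _     = case le of λ ()
        ... | no b∉c | _       = contradiction b∈c b∉c

    far-covers : ∀ {b c} → colour b ≡ c → Far (leader c) b → Covers b (lo (leader c))
    far-covers {b} {c} b∈c far with leader-spec b∈c
    ... | s∈c , lo≤ = lo≤ , ≮⇒≥ (separated far)
      where
        separated : Far (leader c) b → ¬ (hi b < lo (leader c))
        separated (inj₁ b+δ≤s) hi<lo′ =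
          up-sep (+δ≤⇒Before b+δ≤s , hi<lo′) (cong proj₁ (trans b∈c (sym s∈c)))
        separated (inj₂ s+δ≤b) hi<lo′ =
          down-sep (+δ≤⇒Before s+δ≤b , hi<lo′) (cong proj₂ (trans s∈c (sym b∈c)))

    Code : Set
    Code = Colour × Tag

    code : Fin n → Code
    code b = colour b , tag (leader (colour b)) b

    code-injective : ∀ {b₁ b₂} → code b₁ ≡ code b₂ → b₁ ≡ b₂
    code-injective {b₁} {b₂} eq with ,-injective eq
    ... | c≡ , t≡ = tag-injective (leader (colour b₂)) (far-covers c≡) (far-covers refl)
                      (trans (cong (λ c → tag (leader c) b₁) (sym c≡)) t≡)

    codes : Fin ((m * m) * (L + (L + δ) + (δ + δ) * δ)) ↔ Code
    codes = ↔-trans Fin.*↔× (Fin.*↔× ×-↔ ↔-trans Fin.+↔⊎ (↔-refl ⊎-↔ Fin.*↔×))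

    blocks≤codes : n ≤ (m * m) * (L + (L + δ) + (δ + δ) * δ)
    blocks≤codes = Fin.injective⇒≤ (code-injective ∘ Injection.injective (↔⇒↣ (↔-sym codes)))

  ascending⊎descending : (m * m) * (L + (L + δ) + (δ + δ) * δ) < n →
                         Chain _⊏↑_ (suc m) ⊎ Chain _⊏↓_ (suc m)
  ascending⊎descending codes<n
    with chain⊎antichainColouring _⊏↑?_ ⊏↑-trans m
       | chain⊎antichainColouring _⊏↓?_ ⊏↓-trans m
  ... | inj₁ ascending        | _                        = inj₁ ascending
  ... | inj₂ _                | inj₁ descending          = inj₂ descending
  ... | inj₂ (up , up-sep)    | inj₂ (down , down-sep)   =
    contradiction codes<n (≤⇒≯ (Colouring.blocks≤codes b₀ up up-sep down down-sep))
    where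
      b₀ : Fin n
      b₀ = fromℕ< (≤-<-trans z≤n codes<n)

-- The choice δ = 4m², L = 16m⁴ + 2m² + 1 (with m = n + 1 in sixth-power) gives
-- L + δ ≤ (m + 1)⁶ and L·δ = m²·(2L + δ + 2δ²) + 2m².
sixth-power : ∀ n → (2 + n) * ((2 + n) * ((2 + n) * ((2 + n) * ((2 + n) * ((2 + n) * 1))))) ≡
  suc (16 * ((suc n * suc n) * (suc n * suc n)) + 2 * (suc n * suc n)) + 4 * (suc n * suc n)
  + (n * n * n * n * n * n + 12 * (n * n * n * n * n) + 44 * (n * n * n * n)
     + 96 * (n * n * n) + 138 * (n * n) + 116 * n + 41)
sixth-power = solve-∀

blocks-identity : ∀ m → suc (16 * ((m * m) * (m * m)) + 2 * (m * m)) * (4 * (m * m)) ≡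
  (m * m) * (suc (16 * ((m * m) * (m * m)) + 2 * (m * m))
             + (suc (16 * ((m * m) * (m * m)) + 2 * (m * m)) + 4 * (m * m))
             + (4 * (m * m) + 4 * (m * m)) * (4 * (m * m)))
  + 2 * (m * m)
blocks-identity = solve-∀

module _ (m₀ : ℕ) where

  private
    m k δ L : ℕ
    m = suc m₀
    k = suc m
    δ = 4 * (m * m)
    L = suc (16 * ((m * m) * (m * m)) + 2 * (m * m))

    L+δ≤k⁶ : L + δ ≤ k ^ 6
    L+δ≤k⁶ = subst (L + δ ≤_) (sym (sixth-power m₀)) (m≤m+n (L + δ) _)

    codes<blocks : (m * m) * (L + (L + δ) + (δ + δ) * δ) < L * δ
    codes<blocks = subst ((m * m) * (L + (L + δ) + (δ + δ) * δ) <_) (sym (blocks-identity m))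
                         (m<m+n _ (s≤s z≤n))

  containsThick-suc : (e : Fin (k ^ 7) → Fin (k ^ 7) → Edge) → IsDiamond (k ^ 7) e →
                      ContainsThick {Fin (k ^ 7) × Fin (k ^ 7)} (λ p → e (proj₁ p) (proj₂ p)) k
  containsThick-suc e diamond =
    [ inj₁ ∘ thickTwist ∘ Chain-map block-at (λ ((R< , C<) , hi<lo′) → ⇗-intro R< C< hi<lo′)
    , inj₂ ∘ thickRainbow ∘ Chain-map block-at (λ ((R< , C<) , hi′<lo) → ⇘-intro R< C< hi′<lo)
    ]′ (ascending⊎descending codes<blocks)
    where
      open Blocks diamond m (L + δ) (*-monoʳ-≤ k L+δ≤k⁶)

      R I : Fin (L * δ) → ℕ
      R b = toℕ (proj₁ (remQuot {L} δ b))
      I b = toℕ (proj₂ (remQuot {L} δ b))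

      R<L : ∀ b → R b < L
      R<L b = Fin.toℕ<n _

      I<δ : ∀ b → I b < δ
      I<δ b = Fin.toℕ<n _

      block-at : Fin (L * δ) → Block
      block-at b = block (R b) (R b + I b) (≤-trans (R<L b) (m≤m+n L δ)) (+-mono-< (R<L b) (I<δ b))

      RI-injective : ∀ {b b′} → R b ≡ R b′ → I b ≡ I b′ → b ≡ b′
      RI-injective R≡ I≡ = Injection.injective (↔⇒↣ (Fin.*↔× {L} {δ}))
                              (cong₂ _,_ (Fin.toℕ-injective R≡) (Fin.toℕ-injective I≡))

      open BlockCounting m L δ R I R<L I<δ RI-injective
                        (lo ∘ block-at) (hi ∘ block-at) (lo≤hi ∘ block-at)
                        (λ {b} {b′} → hi<lo {block-at b} {block-at b′})

lemma18 : (k : ℕ) (e : Fin (k ^ 7) → Fin (k ^ 7) → Edge) →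
    IsDiamond (k ^ 7) e →
    ContainsThick {Fin (k ^ 7) × Fin (k ^ 7)} (λ p → e (proj₁ p) (proj₂ p)) k
lemma18 zero          e _ = inj₁ ((λ ()) , (λ ()) , (λ ()))
lemma18 (suc zero)    e _ =
  inj₁ ((λ _ _ → zero , zero) , (λ { zero zero _ _ () }) , (λ { zero zero zero () }))
lemma18 (suc (suc m)) e   = containsThick-suc m e
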